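{- Let $n\geq 2$ be finite. If $\mathfrak A\in SA_n$ is completely representable, then so is its minimal completion.
   Context: Fix finite $n\geq 2$. $[i,j]$ is the transposition of $n$ swapping $i,j$; $[i/j]:n\to n$ maps $i$ to $j$ and is the identity elsewhere. An $SA_n$-type algebra is a Boolean algebra with unary operations $s^i_j,s_{ij}$ ($i\neq j<n$). For a word $t$ over these symbols define $\hat t\in{}^nn$: empty word $\mapsto Id_n$, $(s_{ij}t)^{\hat{}}=[i,j]\circ\hat t$, $(s^i_jt)^{\hat{}}=[i/j]\circ\hat t$. $\Sigma'_n$: Boolean axioms; each $s^i_j,s_{ij}$ preserves $\wedge$ and $-$; $t_1(x)=t_2(x)$ whenever $\hat t_1=\hat t_2$. $SA_n=\mathbf{Mod}(\Sigma'_n)$. $V\subseteq{}^nU$ is dipermutable if $s\in V$ implies $s\circ[i/j],s\circ[i,j]\in V$; $\wp(V)$ is $\mathcal P(V)$ with $\cap$, complement relative to $V$, $S^i_j(X)=\{q\in V:q\circ[i/j]\in X\}$, $S_{ij}(X)=\{q\in V:q\circ[i,j]\in X\}$. A complete representation is an injective homomorphism $f:\mathfrak A\to\wp(V)$, $V$ dipermutable, with $f(\prod X)=\bigcap f[X]$ whenever $\prod X$ exists. The minimal completion of an atomic algebra $\mathfrak A$ (a completely representable algebra is atomic) is the complex algebra of its atom structure: universe $\mathcal P(\mathrm{At}\mathfrak A)$ with set operations and, for each unary operator $g$, $g(X)=\{b\in\mathrm{At}\mathfrak A: b\leq g(x)\text{ for some }x\in X\}$; $\mathfrak A$ embeds into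 it via $a\mapsto\{b\in\mathrm{At}\mathfrak A:b\leq a\}$. -}

module Defs where

open import Level using (Level; _⊔_; suc; Lift)
open import Data.Nat using (ℕ)
open import Data.Fin using (Fin; _≟_)
open import Data.Fin.Permutation.Components using (transpose)
open import Data.Bool using (if_then_else_)
open import Data.List using (List; []; _∷_)
open import Data.Product using (Σ; _×_; _,_; proj₁; proj₂)
open import Data.Sum using (_⊎_)
import Data.Sum
open import Data.Empty using () renaming (⊥ to Empty)
open import Data.Unit.Polymorphic using () renaming (⊤ to Unit)
open import Function using (_∘_)
open import Relation.Nullary using (does) renaming (¬_ to Not)
open import Relation.Unary using (Pred; _⊆_; _≐_)
open import Relation.Binary using (Rel)
open import Relation.Binary.PropositionalEquality using (_≡_; _≢_)
open import Algebra.Core using (Op₁; Op₂)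
open import Algebra.Lattice.Bundles using (BooleanAlgebra)

[_/_] : ∀ {n} → Fin n → Fin n → Fin n → Fin n
[ i / j ] k = if does (k ≟ i) then j else k

[_,_] : ∀ {n} → Fin n → Fin n → Fin n → Fin n
[ i , j ] = transpose i j

data Sym (n : ℕ) : Set where
  sub : (i j : Fin n) → .(i ≢ j) → Sym n
  swp : (i j : Fin n) → .(i ≢ j) → Sym n

⟦_⟧ˢ : ∀ {n} → Sym n → Fin n → Fin n
⟦ sub i j _ ⟧ˢ = [ i / j ]
⟦ swp i j _ ⟧ˢ = [ i , j ]

hat : ∀ {n} → List (Sym n) → Fin n → Fin n
hat []      = λ k → k
hat (σ ∷ t) = ⟦ σ ⟧ˢ ∘ hat t

record SARaw (n : ℕ) (c ℓ : Level) : Set (suc (c ⊔ ℓ)) where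
  infix 4 _≈_ _≤_
  field
    Carrier : Set c
    _≈_     : Rel Carrier ℓ
    _∨_     : Op₂ Carrier
    _∧_     : Op₂ Carrier
    ¬_      : Op₁ Carrier
    ⊤       : Carrier
    ⊥       : Carrier
    s[_/_]  : (i j : Fin n) → .(i ≢ j) → Op₁ Carrier
    s[_,_]  : (i j : Fin n) → .(i ≢ j) → Op₁ Carrier

  _≤_ : Rel Carrier ℓ
  x ≤ y = (x ∧ y) ≈ x

  IsInf : ∀ {r} → Pred Carrier r → Carrier → Set (c ⊔ ℓ ⊔ r)
  IsInf X m = (∀ x → X x → m ≤ x)
            × (∀ y → (∀ x → X x → y ≤ x) → y ≤ m)

  IsAtom : Carrier → Set (c ⊔ ℓ)
  IsAtom b = (Not (b ≈ ⊥)) × (∀ x → x ≤ b → (x ≈ ⊥) ⊎ (x ≈ b))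

  At : Set (c ⊔ ℓ)
  At = Σ Carrier IsAtom

  op : Sym n → Op₁ Carrier
  op (sub i j p) = s[ i / j ] p
  op (swp i j p) = s[ i , j ] p

  app : List (Sym n) → Op₁ Carrier
  app []      x = x
  app (σ ∷ t) x = op σ (app t x)

record SAType (n : ℕ) (c ℓ : Level) : Set (suc (c ⊔ ℓ)) where
  field
    BA : BooleanAlgebra c ℓ
  open BooleanAlgebra BA public
  field
    s[_/_]  : (i j : Fin n) → .(i ≢ j) → Op₁ Carrier
    s[_,_]  : (i j : Fin n) → .(i ≢ j) → Op₁ Carrier
    s/-cong : ∀ i j .(p : i ≢ j) {x y} → x ≈ y → s[ i / j ] p x ≈ s[ i / j ] p y
    s,-cong : ∀ i j .(p : i ≢ j) {x y} → x ≈ y → s[ i , j ] p x ≈ s[ i , j ] p y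

  raw : SARaw n c ℓ
  raw = record
    { Carrier = Carrier ; _≈_ = _≈_ ; _∨_ = _∨_ ; _∧_ = _∧_ ; ¬_ = ¬_
    ; ⊤ = ⊤ ; ⊥ = ⊥ ; s[_/_] = s[_/_] ; s[_,_] = s[_,_] }

-- Membership in SA_n = Mod(Σ'_n)  (Boolean axioms are already in SAType)
IsSA : ∀ {n c ℓ} → SAType n c ℓ → Set (c ⊔ ℓ)
IsSA {n} A =
    (∀ i j .(p : i ≢ j) x y → s[ i / j ] p (x ∧ y) ≈ (s[ i / j ] p x ∧ s[ i / j ] p y))
  × (∀ i j .(p : i ≢ j) x y → s[ i , j ] p (x ∧ y) ≈ (s[ i , j ] p x ∧ s[ i , j ] p y))
  × (∀ i j .(p : i ≢ j) x → s[ i / j ] p (¬ x) ≈ ¬ (s[ i / j ] p x))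
  × (∀ i j .(p : i ≢ j) x → s[ i , j ] p (¬ x) ≈ ¬ (s[ i , j ] p x))
  × (∀ (t₁ t₂ : List (Sym n)) → (∀ k → hat t₁ k ≡ hat t₂ k) → ∀ x → app t₁ x ≈ app t₂ x)
  where open SAType A
        open SARaw raw using (app)

-- Complete representations  f : 𝔄 → ℘(V),  V ⊆ ⁿU dipermutable.
-- Elements of ℘(V) are subsets of V (predicates on ⁿU contained in V),
-- compared extensionally (≐).

record CompleteRep {n c ℓ} (A : SARaw n c ℓ) (u p : Level)
       : Set (suc (c ⊔ ℓ ⊔ u ⊔ p)) where
  open SARaw A
  field
    U       : Set u
    V       : Pred (Fin n → U) p
    dip-sub : ∀ (i j : Fin n) (s : Fin n → U) → V s → V (s ∘ [ i / j ])
    dip-swp : ∀ (i j : Fin n) (s : Fin n → U) → V s → V (s ∘ [ i , j ])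
    f       : Carrier → Pred (Fin n → U) p
    f⊆V     : ∀ x → f x ⊆ V
    f-cong  : ∀ {x y} → x ≈ y → f x ≐ f y
    f-inj   : ∀ {x y} → f x ≐ f y → x ≈ y
    f-∧     : ∀ x y → f (x ∧ y) ≐ (λ q → f x q × f y q)
    f-∨     : ∀ x y → f (x ∨ y) ≐ (λ q → f x q ⊎ f y q)
    f-¬     : ∀ x → f (¬ x) ≐ (λ q → V q × (Not (f x q)))
    f-⊤     : f ⊤ ≐ V
    f-⊥     : f ⊥ ≐ (λ _ → Lift p Empty)
    f-sub   : ∀ i j .(h : i ≢ j) x →
              f (s[ i / j ] h x) ≐ (λ q → V q × f x (q ∘ [ i / j ]))
    f-swp   : ∀ i j .(h : i ≢ j) x →
              f (s[ i , j ] h x) ≐ (λ q → V q × f x (q ∘ [ i , j ]))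
    -- f(∏X) = ⋂ f[X] whenever ∏X exists (⋂ of the empty family is V)
    f-complete : ∀ (X : Pred Carrier (c ⊔ ℓ)) m → IsInf X m →
                 f m ≐ (λ q → V q × (∀ x → X x → f x q))

CompletelyRepresentable : ∀ {n c ℓ} → SARaw n c ℓ → (u p : Level) → Set (suc (c ⊔ ℓ ⊔ u ⊔ p))
CompletelyRepresentable A u p = CompleteRep A u p

-- Minimal completion: the complex algebra of the atom structure.
-- Atoms are elements of the setoid, so subsets of At𝔄 are predicates
-- on At invariant under ≈.

module _ {n c ℓ} (A : SAType n c ℓ) where
  open SAType A
  open SARaw raw using (_≤_; At)

  private
    ≤-resp : ∀ {x x' y} → x ≈ x' → x ≤ y → x' ≤ y
    ≤-resp e h = trans (∧-cong (sym e) refl) (trans h e)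

  Respects≈ : (At → Set (c ⊔ ℓ)) → Set (c ⊔ ℓ)
  Respects≈ P = ∀ {b b' : At} → proj₁ b ≈ proj₁ b' → P b → P b'

  CmSet : Set (suc (c ⊔ ℓ))
  CmSet = Σ (At → Set (c ⊔ ℓ)) Respects≈

  lift-op : Op₁ Carrier → CmSet → CmSet
  lift-op g (X , _) =
      (λ b → Σ At (λ x → X x × (proj₁ b ≤ g (proj₁ x))))
    , (λ e (x , xX , le) → x , xX , ≤-resp e le)

  Cm : SARaw n (suc (c ⊔ ℓ)) (c ⊔ ℓ)
  Cm = record
    { Carrier = CmSet
    ; _≈_ = λ X Y → ∀ b → (proj₁ X b → proj₁ Y b) × (proj₁ Y b → proj₁ X b)
    ; _∨_ = λ X Y → (λ b → proj₁ X b ⊎ proj₁ Y b)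
                  , (λ e → Data.Sum.map (proj₂ X e) (proj₂ Y e))
    ; _∧_ = λ X Y → (λ b → proj₁ X b × proj₁ Y b)
                  , (λ e (x , y) → proj₂ X e x , proj₂ Y e y)
    ; ¬_  = λ X → (λ b → Not (proj₁ X b)) , (λ e nx x → nx (proj₂ X (sym e) x))
    ; ⊤   = (λ _ → Unit) , (λ _ t → t)
    ; ⊥   = (λ _ → Lift (c ⊔ ℓ) Empty) , (λ _ z → z)
    ; s[_/_] = λ i j p → lift-op (s[ i / j ] p)
    ; s[_,_] = λ i j p → lift-op (s[ i , j ] p)
    }

module Submission where

-- Let f : 𝔄 → ℘(V) be a complete representation.  The heart of the proof is
-- that the images of the atoms of 𝔄 partition V:
--   * two atoms whose images meet are equal, since b ∧ b' ≠ 0 forces b = b';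
--   * every q ∈ V lies in the image of some atom: the set Xq of elements whose
--     image contains q either has a non-zero lower bound, which is then an atom
--     containing q, or has infimum 0, and completeness gives q ∈ f(0) = ∅.
-- The representation of the complex algebra Cm(At 𝔄) is F(Z) = ⋃_{b ∈ Z} f(b).
-- Because of the partition, F commutes with the Boolean operations and with
-- arbitrary meets, it is injective because atoms have non-empty images, and it
-- commutes with the lifted substitutions because f does.  Classical logic is
-- used for the existence part and to resize Xq to the universe level at which
-- completeness is stated.

open import Defs
open import Level using (_⊔_; Lift; lift; lower)
open import Data.Nat using (ℕ; _≤_)
open import Axiom.ExcludedMiddle using (ExcludedMiddle)
open import Data.Product using (Σ; _×_; _,_; proj₁; proj₂)
open import Data.Sum using (_⊎_; inj₁; inj₂)
open import Data.Empty using (⊥-elim) renaming (⊥ to Empty)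
open import Data.Fin using (Fin)
open import Relation.Nullary using (yes; no) renaming (¬_ to Not)
open import Relation.Nullary.Decidable using (True; toWitness; fromWitness)
open import Function using (_∘_)
open import Relation.Unary using (Pred; _≐_)
import Algebra.Lattice.Properties.BooleanAlgebra as BooleanAlgebraProperties
import Algebra.Lattice.Properties.Lattice as LatticeProperties
import Algebra.Lattice.Properties.Semilattice as SemilatticeProperties
open import Relation.Binary.Bundles using (Poset)
open import Relation.Binary.Lattice.Bundles using (MeetSemilattice)

-- The order x ≼ y ⇔ x ∧ y ≈ x of an SA_n-type algebra; it is the library's
-- natural order of the meet semilattice, up to symmetry of ≈.
module BooleanOrder {n c ℓ} (A : SAType n c ℓ) where
  open SAType A
  open SARaw raw using () renaming (_≤_ to _≼_)
  open BooleanAlgebraProperties BA using (∧-zeroʳ)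
  open LatticeProperties lattice using (∧-semilattice)
  open Poset (SemilatticeProperties.poset ∧-semilattice)
    using () renaming (trans to ≤-trans; antisym to ≤-antisym)
  open MeetSemilattice (SemilatticeProperties.∧-orderTheoreticMeetSemilattice ∧-semilattice)
    using (x∧y≤x)

  ≼-trans : ∀ {x y z} → x ≼ y → y ≼ z → x ≼ z
  ≼-trans h k = sym (≤-trans (sym h) (sym k))

  ≼-antisym : ∀ {x y} → x ≼ y → y ≼ x → x ≈ y
  ≼-antisym h k = ≤-antisym (sym h) (sym k)

  x∧y≼x : ∀ x y → (x ∧ y) ≼ x
  x∧y≼x x y = sym (x∧y≤x x y)

  ⊥-≼ : ∀ x → ⊥ ≼ x
  ⊥-≼ x = trans (∧-comm ⊥ x) (∧-zeroʳ x)

  ≼-complement⇒⊥ : ∀ {y} → y ≼ (¬ y) → y ≈ ⊥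
  ≼-complement⇒⊥ {y} h = trans (sym h) (∧-complementʳ y)

module AtomImages {n c ℓ} (A : SAType n c ℓ) {u p} (R : CompleteRep (SAType.raw A) u p) where
  open SAType A
  open SARaw raw using (At) renaming (_≤_ to _≼_)
  open CompleteRep R
  open BooleanOrder A

  image-of-zero : ∀ {x q} → x ≈ ⊥ → Not (f x q)
  image-of-zero x≈⊥ fx = lower (proj₁ f-⊥ (proj₁ (f-cong x≈⊥) fx))

  f-monotone : ∀ {x y} → x ≼ y → ∀ {q} → f x q → f y q
  f-monotone {x} {y} x≼y fx = proj₂ (proj₁ (f-∧ x y) (proj₁ (f-cong (sym x≼y)) fx))

  -- an atom whose image meets f(y) lies below y, since b ∧ y is then non-zero
  atom-below : ∀ (b : At) y {q} → f (proj₁ b) q → f y q → proj₁ b ≼ y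
  atom-below (b , _ , atomic) y fb fy with atomic (b ∧ y) (x∧y≼x b y)
  ... | inj₁ b∧y≈⊥ = ⊥-elim (image-of-zero b∧y≈⊥ (proj₂ (f-∧ b y) (fb , fy)))
  ... | inj₂ b∧y≈b = b∧y≈b

  atoms-meet⇒equal : ∀ (b b' : At) {q} → f (proj₁ b) q → f (proj₁ b') q → proj₁ b ≈ proj₁ b'
  atoms-meet⇒equal b (b' , _ , atomic') fb fb' with atomic' (proj₁ b) (atom-below b b' fb fb')
  ... | inj₁ b≈⊥ = ⊥-elim (proj₁ (proj₂ b) b≈⊥)
  ... | inj₂ b≈b' = b≈b'

module AtomCover (em : ∀ {r} → ExcludedMiddle r)
  {n c ℓ} (A : SAType n c ℓ) {u p} (R : CompleteRep (SAType.raw A) u p) where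
  open SAType A
  open SARaw raw using (At; IsAtom; IsInf) renaming (_≤_ to _≼_)
  open CompleteRep R
  open BooleanOrder A
  open AtomImages A R using (image-of-zero)
  open BooleanAlgebraProperties BA using (∧-zeroʳ)

  -- Xq = {x : q ∈ f(x)}, resized (via excluded middle) to the level c ⊔ ℓ
  -- at which completeness of f can be applied to it
  Contains : (Fin n → U) → Pred Carrier (c ⊔ ℓ)
  Contains q x = Lift (c ⊔ ℓ) (True (em {p} {f x q}))

  contains : ∀ {q x} → f x q → Contains q x
  contains = lift ∘ fromWitness

  contained : ∀ {q x} → Contains q x → f x q
  contained = toWitness ∘ lower

  LowerBound : (Fin n → U) → Carrier → Set (c ⊔ ℓ)
  LowerBound q y = ∀ x → Contains q x → y ≼ x

  -- if q ∉ f(z) then q ∈ f(¬ z), so a lower bound of Xq lies below ¬ z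
  below-complement : ∀ {q y z} → V q → LowerBound q y → Not (f z q) → y ≼ (¬ z)
  below-complement {z = z} v lb nz = lb (¬ z) (contains (proj₂ (f-¬ z) (v , nz)))

  -- a non-zero lower bound of Xq contains q ...
  lower-bound-contains : ∀ {q y} → V q → Not (y ≈ ⊥) → LowerBound q y → f y q
  lower-bound-contains {q} {y} v y≉⊥ lb with em {p} {f y q}
  ... | yes fy = fy
  ... | no ¬fy = ⊥-elim (y≉⊥ (≼-complement⇒⊥ (below-complement v lb ¬fy)))

  -- ... and is an atom: each z ≼ y is either in Xq (so z = y) or below ¬ z (so z = 0)
  lower-bound-atom : ∀ {q y} → V q → Not (y ≈ ⊥) → LowerBound q y → IsAtom y
  lower-bound-atom {q} {y} v y≉⊥ lb = y≉⊥ , below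
    where
    below : ∀ z → z ≼ y → (z ≈ ⊥) ⊎ (z ≈ y)
    below z z≼y with em {p} {f z q}
    ... | yes fz = inj₂ (≼-antisym z≼y (lb z (contains fz)))
    ... | no ¬fz = inj₁ (≼-complement⇒⊥ (≼-trans z≼y (below-complement v lb ¬fz)))

  zero-infimum : ∀ {q} → Not (Σ Carrier (λ y → Not (y ≈ ⊥) × LowerBound q y)) →
                 IsInf (Contains q) ⊥
  zero-infimum {q} no-bound = (λ x _ → ⊥-≼ x) , greatest
    where
    greatest : ∀ y → LowerBound q y → y ≼ ⊥
    greatest y lb with em {ℓ} {y ≈ ⊥}
    ... | yes y≈⊥ = trans (∧-zeroʳ y) (sym y≈⊥)
    ... | no y≉⊥ = ⊥-elim (no-bound (y , y≉⊥ , lb))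

  -- every point of V lies in the image of an atom; otherwise completeness
  -- would put q into f(0) = ∅
  cover : ∀ q → V q → Σ At (λ b → f (proj₁ b) q)
  cover q v with em {c ⊔ ℓ} {Σ Carrier (λ y → Not (y ≈ ⊥) × LowerBound q y)}
  ... | yes (y , y≉⊥ , lb) = (y , lower-bound-atom v y≉⊥ lb) , lower-bound-contains v y≉⊥ lb
  ... | no no-bound = ⊥-elim (image-of-zero refl
        (proj₂ (f-complete (Contains q) ⊥ (zero-infimum no-bound)) (v , λ _ → contained)))

  -- atoms are non-zero and f is injective, so their images are inhabited
  atom-image-inhabited : ∀ (b : At) → Σ (Fin n → U) (f (proj₁ b))
  atom-image-inhabited (b , b≉⊥ , _) with em {u ⊔ p} {Σ (Fin n → U) (f b)}
  ... | yes inhabited = inhabited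
  ... | no empty = ⊥-elim (b≉⊥ (f-inj ((λ fb → ⊥-elim (empty (_ , fb)))
                                     , (λ f⊥ → ⊥-elim (image-of-zero refl f⊥)))))

module CompletionRepresentation (em : ∀ {r} → ExcludedMiddle r)
  {n c ℓ} (A : SAType n c ℓ) {u p} (R : CompleteRep (SAType.raw A) u p) where
  open SAType A
  open SARaw raw using (At)
  open CompleteRep R
  open AtomImages A R using (f-monotone; atom-below; atoms-meet⇒equal)
  open AtomCover em A R using (cover; atom-image-inhabited)
  module Cm𝔄 = SARaw (Cm A)

  V̂ : Pred (Fin n → U) (p ⊔ c ⊔ ℓ)
  V̂ q = Lift (c ⊔ ℓ) (V q)

  F : CmSet A → Pred (Fin n → U) (p ⊔ c ⊔ ℓ)
  F Z q = Σ At (λ b → proj₁ Z b × f (proj₁ b) q)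

  atom-in : ∀ Z (b : At) {q} → f (proj₁ b) q → F Z q → proj₁ Z b
  atom-in Z b fb (b' , Zb' , fb') = proj₂ Z (atoms-meet⇒equal b' b fb' fb) Zb'

  F⊆V̂ : ∀ Z {q} → F Z q → V̂ q
  F⊆V̂ Z (b , _ , fb) = lift (f⊆V _ fb)

  F-cong : ∀ {Z Z'} → Z Cm𝔄.≈ Z' → F Z ≐ F Z'
  F-cong Z≈Z' = (λ (b , Zb , fb) → b , proj₁ (Z≈Z' b) Zb , fb)
              , (λ (b , Z'b , fb) → b , proj₂ (Z≈Z' b) Z'b , fb)

  -- F reflects membership of atoms, because atom images are inhabited
  F-inj : ∀ {Z Z'} → F Z ≐ F Z' → Z Cm𝔄.≈ Z'
  F-inj {Z} {Z'} (F⊆ , F⊇) b = transfer Z Z' F⊆ , transfer Z' Z F⊇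
    where
    transfer : ∀ Y Y' → (∀ {q} → F Y q → F Y' q) → proj₁ Y b → proj₁ Y' b
    transfer Y Y' FY⊆FY' Yb =
      let (_ , fb) = atom-image-inhabited b in atom-in Y' b fb (FY⊆FY' (b , Yb , fb))

  F-∧ : ∀ Z Z' → F (Z Cm𝔄.∧ Z') ≐ (λ q → F Z q × F Z' q)
  F-∧ Z Z' = (λ (b , (Zb , Z'b) , fb) → (b , Zb , fb) , (b , Z'b , fb))
           , (λ ((b , Zb , fb) , inZ') → b , (Zb , atom-in Z' b fb inZ') , fb)

  F-∨ : ∀ Z Z' → F (Z Cm𝔄.∨ Z') ≐ (λ q → F Z q ⊎ F Z' q)
  F-∨ Z Z' = (λ { (b , inj₁ Zb , fb) → inj₁ (b , Zb , fb)
                ; (b , inj₂ Z'b , fb) → inj₂ (b , Z'b , fb) })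
           , (λ { (inj₁ (b , Zb , fb)) → b , inj₁ Zb , fb
                ; (inj₂ (b , Z'b , fb)) → b , inj₂ Z'b , fb })

  F-¬ : ∀ Z → F (Cm𝔄.¬ Z) ≐ (λ q → V̂ q × Not (F Z q))
  F-¬ Z = (λ (b , ¬Zb , fb) → lift (f⊆V _ fb) , (λ inZ → ¬Zb (atom-in Z b fb inZ)))
        , (λ (lift v , ¬inZ) → let (b , fb) = cover _ v in b , (λ Zb → ¬inZ (b , Zb , fb)) , fb)

  F-⊤ : F Cm𝔄.⊤ ≐ V̂
  F-⊤ = F⊆V̂ Cm𝔄.⊤ , (λ (lift v) → let (b , fb) = cover _ v in b , _ , fb)

  F-⊥ : F Cm𝔄.⊥ ≐ (λ _ → Lift (p ⊔ c ⊔ ℓ) Empty)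
  F-⊥ = (λ (_ , ∅ , _) → ⊥-elim (lower ∅)) , (λ ∅ → ⊥-elim (lower ∅))

  -- F commutes with the lifting of any operator that f turns into
  -- precomposition with a map σ; this covers all s^i_j and s_ij
  F-lift-op : ∀ (s : Carrier → Carrier) (σ : Fin n → Fin n) →
              (∀ x → f (s x) ≐ (λ q → V q × f x (q ∘ σ))) →
              ∀ Z → F (lift-op A s Z) ≐ (λ q → V̂ q × F Z (q ∘ σ))
  F-lift-op s σ f-s Z = image⊆ , image⊇
    where
    image⊆ : ∀ {q} → F (lift-op A s Z) q → V̂ q × F Z (q ∘ σ)
    image⊆ (b , (x , Zx , b≼sx) , fb) =
      let (v , fx) = proj₁ (f-s (proj₁ x)) (f-monotone b≼sx fb) in lift v , x , Zx , fx
    image⊇ : ∀ {q} → V̂ q × F Z (q ∘ σ) → F (lift-op A s Z) q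
    image⊇ {q} (lift v , x , Zx , fx) =
      let (b , fb) = cover q v
      in b , (x , Zx , atom-below b _ fb (proj₂ (f-s (proj₁ x)) (v , fx))) , fb

  singleton : At → CmSet A
  singleton b = (λ b' → Lift c (proj₁ b' ≈ proj₁ b))
              , (λ b'≈b'' s → lift (trans (sym b'≈b'') (lower s)))

  singleton-below : ∀ b Y → proj₁ Y b → singleton b Cm𝔄.≤ Y
  singleton-below b Y Yb b' = proj₁ , (λ s → s , proj₂ Y (sym (lower s)) Yb)

  -- F turns meets in Cm 𝔄 into intersections: if q lies in every F(Y), Y ∈ X,
  -- its atom b lies in every Y, so {b} ≤ ∏X and b ∈ ∏X
  F-complete : ∀ (X : Pred (CmSet A) (Level.suc (c ⊔ ℓ))) m → Cm𝔄.IsInf X m →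
               F m ≐ (λ q → V̂ q × (∀ Y → X Y → F Y q))
  F-complete X m (m-lower , m-greatest) = image⊆ , image⊇
    where
    image⊆ : ∀ {q} → F m q → V̂ q × (∀ Y → X Y → F Y q)
    image⊆ (b , mb , fb) = lift (f⊆V _ fb) , λ Y XY → b , proj₂ (proj₂ (m-lower Y XY b) mb) , fb
    image⊇ : ∀ {q} → V̂ q × (∀ Y → X Y → F Y q) → F m q
    image⊇ {q} (lift v , in-all) =
      let (b , fb) = cover q v
          b-lower = λ Y XY → singleton-below b Y (atom-in Y b fb (in-all Y XY))
      in b , proj₂ (proj₂ (m-greatest (singleton b) b-lower b) (lift refl)) , fb

  representation : CompleteRep (Cm A) u (p ⊔ c ⊔ ℓ)
  representation = record
    { U = U
    ; V = V̂
    ; dip-sub = λ i j s v → lift (dip-sub i j s (lower v))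
    ; dip-swp = λ i j s v → lift (dip-swp i j s (lower v))
    ; f = F
    ; f⊆V = F⊆V̂
    ; f-cong = λ {Z} {Z'} → F-cong {Z} {Z'}
    ; f-inj = λ {Z} {Z'} → F-inj {Z} {Z'}
    ; f-∧ = F-∧
    ; f-∨ = F-∨
    ; f-¬ = F-¬
    ; f-⊤ = F-⊤
    ; f-⊥ = F-⊥
    ; f-sub = λ i j h → F-lift-op (s[ i / j ] h) [ i / j ] (f-sub i j h)
    ; f-swp = λ i j h → F-lift-op (s[ i , j ] h) [ i , j ] (f-swp i j h)
    ; f-complete = F-complete
    }

mainTheorem12 : (∀ {r} → ExcludedMiddle r) →
    ∀ (n : ℕ) → 2 ≤ n → ∀ {c ℓ} (A : SAType n c ℓ) → IsSA A →
    ∀ {u p} → CompletelyRepresentable (SAType.raw A) u p →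
    CompletelyRepresentable (Cm A) u (p ⊔ c ⊔ ℓ)
mainTheorem12 em n _ A _ R = CompletionRepresentation.representation em A R
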